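{- Let $L$ and $R$ be finite sets of edges (2-element subsets of $[n]$), possibly intersecting or empty, such that there are no $\{l_1<l_2\}\in L$ and $\{r_1<r_2\}\in R$ with $r_1<l_1<r_2<l_2$. For an edge $e=\{v_1<v_2\}$ consider: (Le) there is no $\{l_1<l_2\}\in L$ with $v_1<l_1<v_2<l_2$; (Re) there is no $\{r_1<r_2\}\in R$ with $r_1<v_1<r_2<v_2$. Let $V\subseteq[n]$, $|V|\ge3$, regarded as the points $\gamma_2(t_i)$, $i\in V$. If every edge of the convex polygon $P=\operatorname{conv}(V)$ satisfies (Le) and (Re), then there is a triangulation $T$ of $P$ with vertex set $V$ such that every edge of $T$ satisfies (Le) and (Re).
   Context: $\gamma_2=\{(t,t^2):t\in\mathbb{R}\}$; fixed reals $t_1<\dots<t_n$, and the point $\gamma_2(t_i)$ is identified with $i\in[n]$, so points indexed by $V$ are in convex position. (This is the special case of the paper's Lemma on $L,M,R$ in which the set $M$ of triangles is empty.) -}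

module Defs where

open import Data.Nat using (ℕ)
open import Data.Fin using (Fin; _<_; _≤_)
open import Data.Fin.Subset using (Subset) renaming (_∈_ to _∈ₛ_)
open import Data.Product using (_×_; _,_; Σ)
open import Data.Sum using (_⊎_)
open import Data.List using (List)
open import Data.List.Membership.Propositional using (_∈_)
open import Relation.Nullary using (¬_)

-- Point i ∈ [n] stands for γ₂(t_i); since t₁ < … < t_n, the index order is the
-- order of the points along the parabola (all points in convex position).
Edge : ℕ → Set
Edge n = Fin n × Fin n

IsEdge : ∀ {n} → Edge n → Set
IsEdge (a , b) = a < b

EdgeList : ℕ → Set
EdgeList n = List (Edge n)

ValidEdges : ∀ {n} → EdgeList n → Set
ValidEdges E = ∀ e → e ∈ E → IsEdge e

Compatible : ∀ {n} → EdgeList n → EdgeList n → Set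
Compatible L R = ∀ l r → l ∈ L → r ∈ R →
  ¬ (Data.Product.proj₁ r < Data.Product.proj₁ l ×
     Data.Product.proj₁ l < Data.Product.proj₂ r ×
     Data.Product.proj₂ r < Data.Product.proj₂ l)

CondL : ∀ {n} → EdgeList n → Edge n → Set
CondL L (v₁ , v₂) = ∀ l₁ l₂ → (l₁ , l₂) ∈ L → ¬ (v₁ < l₁ × l₁ < v₂ × v₂ < l₂)

CondR : ∀ {n} → EdgeList n → Edge n → Set
CondR R (v₁ , v₂) = ∀ r₁ r₂ → (r₁ , r₂) ∈ R → ¬ (r₁ < v₁ × v₁ < r₂ × r₂ < v₂)

PolygonEdge : ∀ {n} → Subset n → Edge n → Set
PolygonEdge V (a , b) = a < b × a ∈ₛ V × b ∈ₛ V ×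
  ((∀ c → c ∈ₛ V → ¬ (a < c × c < b)) ⊎ (∀ c → c ∈ₛ V → (a ≤ c × c ≤ b)))

-- Two segments between points in convex position cross (in their relative
-- interiors) iff their endpoints strictly interleave.
Cross : ∀ {n} → Edge n → Edge n → Set
Cross (a , b) (c , d) = (a < c × c < b × b < d) ⊎ (c < a × a < d × d < b)

-- A triangulation of the convex polygon conv(V) with vertex set V, given by its
-- edge set: a maximal set of pairwise non-crossing segments with endpoints in V.
Triangulation : ∀ {n} → Subset n → EdgeList n → Set
Triangulation {n} V T =
  (∀ a b → (a , b) ∈ T → a < b × a ∈ₛ V × b ∈ₛ V) ×
  (∀ e f → e ∈ T → f ∈ T → ¬ Cross e f) ×
  (∀ a b → a ∈ₛ V → b ∈ₛ V → a < b →
     (∀ f → f ∈ T → ¬ Cross (a , b) f) → (a , b) ∈ T)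

module Submission where

-- Induct on the number of vertices.  Let w₀ < w₁ be the two smallest
-- vertices and wₖ the largest.  If no r ∈ R has r₁ < w₁ < r₂ < wₖ, the
-- diagonal w₁wₖ satisfies (Re), and (Le) is inherited from the polygon edge
-- w₀wₖ; cut off the ear w₀w₁wₖ.  Otherwise take such an r.  The polygon edge
-- straddling r₂ would violate (Re) unless r₂ is itself a vertex, so it is, and
-- the diagonal w₀r₂ is good: (Re) is inherited from w₀wₖ, and an L-edge
-- violating (Le) would either violate (Le) for the polygon edge w₀w₁ or
-- interleave with r.  A good diagonal cuts the polygon into two smaller ones
-- whose polygon edges are again good, and their triangulations together
-- triangulate the whole polygon.

open import Defs
open import Data.Bool using (true; _∧_)
open import Data.Bool.Properties using (∧-conicalˡ; ∧-conicalʳ; T-≡)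
open import Data.Empty using (⊥-elim)
open import Data.Fin using (Fin; zero; suc)
open import Data.Fin.Subset using (Subset; ∣_∣; _⊆_; _⊂_; ⁅_⁆) renaming (_∈_ to _∈ₛ_)
open import Data.Fin.Subset.Induction using (⊂-wellFounded)
open import Data.Fin.Subset.Properties
  using (_∈?_; nonempty?; Empty-unique; ∣⊥∣≡0; x∈⁅x⁆; ∣⁅x⁆∣≡1; p⊆q⇒∣p∣≤∣q∣)
open import Data.List using ([]; _∷_; _++_)
open import Data.List.Membership.Propositional using (_∈_; find; lose)
open import Data.List.Membership.Propositional.Properties using (∈-++⁺ˡ; ∈-++⁺ʳ; ∈-++⁻)
open import Data.List.Relation.Unary.Any using (here; there; any?)
import Data.Nat as ℕ
import Data.Nat.Properties as ℕ
open import Data.Product using (Σ; ∃; ∃₂; _×_; _,_; proj₁; proj₂)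
open import Data.Sum using (_⊎_; inj₁; inj₂; [_,_]′)
open import Data.Vec using (lookup; tabulate)
open import Data.Vec.Properties using (lookup∘tabulate; []=⇒lookup; lookup⇒[]=)
open import Function using (_∘_)
open import Function.Bundles using (Equivalence)
open import Induction.WellFounded using (Acc; acc)
open import Relation.Binary.PropositionalEquality using (_≡_; refl; sym; trans; cong; cong₂; subst)
open import Relation.Nullary using (¬_; yes; no; does; contradiction)
open import Relation.Nullary.Decidable using (dec-true; isYes≗does; toWitness; _×-dec_; ¬?)
open import Relation.Unary using (Decidable)

-- Fin's orders are opened only in this block, since the theorem is stated with ℕ's _≤_.
module _ where
  open import Data.Fin using (_<_; _≤_)
  open import Data.Fin.Properties
    using (_≟_; _≤?_; _<?_; ≤-refl; ≤-trans; ≤-antisym; <-irrefl; <-asym; <-trans; ≤∧≢⇒<)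
    renaming (any? to ∃?)
  open import Data.Nat.Properties using (<⇒≤; <⇒≱; ≤-<-trans; <-≤-trans; ≰⇒>; ≮⇒≥)

  private variable
    n : ℕ.ℕ
    a b c m u x y z : Fin n
    W : Subset n
    T₁ T₂ : EdgeList n

  ≤⇒<⊎≡ : x ≤ y → x < y ⊎ x ≡ y
  ≤⇒<⊎≡ {x = x} {y} x≤y with x ≟ y
  ... | yes x≡y = inj₂ x≡y
  ... | no x≢y = inj₁ (≤∧≢⇒< x≤y x≢y)

  IsLeast IsGreatest : (Fin n → Set) → Fin n → Set
  IsLeast P k = P k × (∀ y → P y → k ≤ y)
  IsGreatest P k = P k × (∀ y → P y → y ≤ k)

  least : {P : Fin n → Set} → Decidable P → ∃ P → ∃ (IsLeast P)
  least P? (zero , p₀) = zero , p₀ , λ _ _ → ℕ.z≤n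
  least P? (suc x , px) with P? zero
  ... | yes p₀ = zero , p₀ , λ _ _ → ℕ.z≤n
  ... | no ¬p₀ with least (P? ∘ suc) (x , px)
  ...   | k , pk , k≤ = suc k , pk , λ { zero p₀ → ⊥-elim (¬p₀ p₀) ; (suc y) py → ℕ.s≤s (k≤ y py) }

  greatest : {P : Fin n → Set} → Decidable P → ∃ P → ∃ (IsGreatest P)
  greatest {n = ℕ.suc _} P? (x , px) with ∃? (P? ∘ suc)
  ... | yes later with greatest (P? ∘ suc) later
  ...   | k , pk , ≤k = suc k , pk , λ { zero _ → ℕ.z≤n ; (suc y) py → ℕ.s≤s (≤k y py) }
  greatest {n = ℕ.suc _} P? (zero , p₀) | no none =
    zero , p₀ , λ { zero _ → ℕ.z≤n ; (suc y) py → ⊥-elim (none (y , py)) }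
  greatest {n = ℕ.suc _} P? (suc x , px) | no none = ⊥-elim (none (x , px))

  two-elements : {W : Subset n} → 2 ℕ.≤ ∣ W ∣ → ∃₂ λ a b → a ∈ₛ W × b ∈ₛ W × a < b
  two-elements {n = n} {W = W} 2≤∣W∣ with nonempty? W
  ... | no empty = contradiction (subst (2 ℕ.≤_) ∣W∣≡0 2≤∣W∣) λ ()
    where
    ∣W∣≡0 : ∣ W ∣ ≡ 0
    ∣W∣≡0 = trans (cong ∣_∣ (Empty-unique empty)) (∣⊥∣≡0 n)
  ... | yes (x , x∈) with least (_∈? W) (x , x∈) | greatest (_∈? W) (x , x∈)
  ...   | a , a∈ , a≤ | b , b∈ , ≤b with ≤⇒<⊎≡ (a≤ b b∈)
  ...     | inj₁ a<b = a , b , a∈ , b∈ , a<b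
  ...     | inj₂ refl = contradiction 2≤1 λ { (ℕ.s≤s ()) }
    where
    W⊆⁅a⁆ : W ⊆ ⁅ a ⁆
    W⊆⁅a⁆ {u} u∈ = subst (_∈ₛ ⁅ a ⁆) (≤-antisym (a≤ u u∈) (≤b u u∈)) (x∈⁅x⁆ a)
    2≤1 : 2 ℕ.≤ 1
    2≤1 = ℕ.≤-trans 2≤∣W∣ (subst (∣ W ∣ ℕ.≤_) (∣⁅x⁆∣≡1 a) (p⊆q⇒∣p∣≤∣q∣ W⊆⁅a⁆))

  filter : Subset n → {P : Fin n → Set} → Decidable P → Subset n
  filter W P? = tabulate λ x → lookup W x ∧ does (P? x)

  module _ {W : Subset n} {P : Fin n → Set} (P? : Decidable P) where

    ∈-filter⁺ : x ∈ₛ W → P x → x ∈ₛ filter W P?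
    ∈-filter⁺ {x} x∈ px =
      lookup⇒[]= x _ (trans (lookup∘tabulate _ x) (cong₂ _∧_ ([]=⇒lookup x∈) (dec-true (P? x) px)))

    ∈-filter⁻ : x ∈ₛ filter W P? → x ∈ₛ W × P x
    ∈-filter⁻ {x} x∈ =
      lookup⇒[]= x W (∧-conicalˡ _ _ both) ,
      toWitness {a? = P? x} (Equivalence.from T-≡ (trans (isYes≗does (P? x)) (∧-conicalʳ _ _ both)))
      where
      both : lookup W x ∧ does (P? x) ≡ true
      both = trans (sym (lookup∘tabulate _ x)) ([]=⇒lookup x∈)

    filter-⊂ : y ∈ₛ W → ¬ P y → filter W P? ⊂ W
    filter-⊂ {y} y∈ ¬py = (λ x∈ → proj₁ (∈-filter⁻ x∈)) , y , y∈ , ¬py ∘ proj₂ ∘ ∈-filter⁻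

  Between StrictlyBetween : Fin n → Fin n → Fin n → Set
  Between a b x = a ≤ x × x ≤ b
  StrictlyBetween a b x = a < x × x < b

  between? : (a b : Fin n) → Decidable (Between a b)
  between? a b x = (a ≤? x) ×-dec (x ≤? b)

  strictlyBetween? : (a b : Fin n) → Decidable (StrictlyBetween a b)
  strictlyBetween? a b x = (a <? x) ×-dec (x <? b)

  -- The diagonal (a , b) cuts conv W into conv (inner W a b) and conv (outer W a b).
  inner outer : Subset n → Fin n → Fin n → Subset n
  inner W a b = filter W (between? a b)
  outer W a b = filter W (¬? ∘ strictlyBetween? a b)

  ¬strictlyBetween-left : ¬ StrictlyBetween a b a
  ¬strictlyBetween-left (a<a , _) = <-irrefl refl a<a

  ¬strictlyBetween-right : ¬ StrictlyBetween a b b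
  ¬strictlyBetween-right (_ , b<b) = <-irrefl refl b<b

  EdgesIn : Subset n → EdgeList n → Set
  EdgesIn W T = ∀ a b → (a , b) ∈ T → a < b × a ∈ₛ W × b ∈ₛ W

  NonCrossing : EdgeList n → Set
  NonCrossing T = ∀ e f → e ∈ T → f ∈ T → ¬ Cross e f

  Maximal : Subset n → EdgeList n → Set
  Maximal W T = ∀ a b → a ∈ₛ W → b ∈ₛ W → a < b → (∀ f → f ∈ T → ¬ Cross (a , b) f) → (a , b) ∈ T

  Cross-sym : ∀ {e f : Edge n} → Cross e f → Cross f e
  Cross-sym {e = _ , _} {_ , _} (inj₁ cross) = inj₂ cross
  Cross-sym {e = _ , _} {_ , _} (inj₂ cross) = inj₁ cross

  ¬Cross-shared : a ≡ c ⊎ a ≡ m ⊎ b ≡ c ⊎ b ≡ m → ¬ Cross (a , b) (c , m)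
  ¬Cross-shared (inj₁ refl) (inj₁ (a<a , _)) = <-irrefl refl a<a
  ¬Cross-shared (inj₁ refl) (inj₂ (a<a , _)) = <-irrefl refl a<a
  ¬Cross-shared (inj₂ (inj₁ refl)) (inj₁ (a<c , c<b , b<a)) = <-irrefl refl (<-trans a<c (<-trans c<b b<a))
  ¬Cross-shared (inj₂ (inj₁ refl)) (inj₂ (_ , a<a , _)) = <-irrefl refl a<a
  ¬Cross-shared (inj₂ (inj₂ (inj₁ refl))) (inj₁ (_ , b<b , _)) = <-irrefl refl b<b
  ¬Cross-shared (inj₂ (inj₂ (inj₁ refl))) (inj₂ (b<a , a<m , m<b)) =
    <-irrefl refl (<-trans b<a (<-trans a<m m<b))
  ¬Cross-shared (inj₂ (inj₂ (inj₂ refl))) (inj₁ (_ , _ , b<b)) = <-irrefl refl b<b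
  ¬Cross-shared (inj₂ (inj₂ (inj₂ refl))) (inj₂ (_ , _ , b<b)) = <-irrefl refl b<b

  ¬Cross-inner-outer : a ≤ x × y ≤ b → ¬ StrictlyBetween a b u × ¬ StrictlyBetween a b m →
                       ¬ Cross (x , y) (u , m)
  ¬Cross-inner-outer (a≤x , y≤b) (u∉ , _) (inj₁ (x<u , u<y , _)) = u∉ (≤-<-trans a≤x x<u , <-≤-trans u<y y≤b)
  ¬Cross-inner-outer (a≤x , y≤b) (_ , m∉) (inj₂ (_ , x<m , m<y)) = m∉ (≤-<-trans a≤x x<m , <-≤-trans m<y y≤b)

  module _ {W : Subset n} {a b : Fin n} where

    ∈-inner⁺ : x ∈ₛ W → Between a b x → x ∈ₛ inner W a b
    ∈-inner⁺ = ∈-filter⁺ (between? a b)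

    ∈-inner⁻ : x ∈ₛ inner W a b → x ∈ₛ W × Between a b x
    ∈-inner⁻ = ∈-filter⁻ (between? a b)

    ∈-outer⁺ : x ∈ₛ W → ¬ StrictlyBetween a b x → x ∈ₛ outer W a b
    ∈-outer⁺ = ∈-filter⁺ (¬? ∘ strictlyBetween? a b)

    ∈-outer⁻ : x ∈ₛ outer W a b → x ∈ₛ W × ¬ StrictlyBetween a b x
    ∈-outer⁻ = ∈-filter⁻ (¬? ∘ strictlyBetween? a b)

    inner-⊂ : y ∈ₛ W → ¬ Between a b y → inner W a b ⊂ W
    inner-⊂ = filter-⊂ (between? a b)

    outer-⊂ : y ∈ₛ W → StrictlyBetween a b y → outer W a b ⊂ W
    outer-⊂ y∈ y∈ab = filter-⊂ (¬? ∘ strictlyBetween? a b) y∈ (λ y∉ab → y∉ab y∈ab)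

    PolygonEdge-inner : a ∈ₛ W → b ∈ₛ W → a ≤ b → ∀ {e} → PolygonEdge (inner W a b) e →
                        PolygonEdge W e ⊎ e ≡ (a , b)
    PolygonEdge-inner a∈ b∈ a≤b {x , y} (x<y , x∈ , y∈ , sides) with ∈-inner⁻ x∈ | ∈-inner⁻ y∈ | sides
    ... | x∈W , a≤x , _ | y∈W , _ , y≤b | inj₁ consecutive =
      inj₁ (x<y , x∈W , y∈W , inj₁ λ c c∈ x<c<y@(x<c , c<y) →
        consecutive c (∈-inner⁺ c∈ (≤-trans a≤x (<⇒≤ x<c) , ≤-trans (<⇒≤ c<y) y≤b)) x<c<y)
    ... | _ , a≤x , _ | _ , _ , y≤b | inj₂ extremal =
      inj₂ (cong₂ _,_ (≤-antisym (proj₁ (extremal a (∈-inner⁺ a∈ (≤-refl , a≤b)))) a≤x)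
                      (≤-antisym y≤b (proj₂ (extremal b (∈-inner⁺ b∈ (a≤b , ≤-refl))))))

    PolygonEdge-outer : a ∈ₛ W → b ∈ₛ W → ∀ {e} → PolygonEdge (outer W a b) e →
                        PolygonEdge W e ⊎ e ≡ (a , b)
    PolygonEdge-outer a∈ b∈ {x , y} (x<y , x∈ , y∈ , inj₂ extremal) =
      inj₁ (x<y , proj₁ (∈-outer⁻ x∈) , proj₁ (∈-outer⁻ y∈) , inj₂ bounds)
      where
      bounds : ∀ c → c ∈ₛ W → x ≤ c × c ≤ y
      bounds c c∈ with strictlyBetween? a b c
      ... | no c∉ab = extremal c (∈-outer⁺ c∈ c∉ab)
      ... | yes (a<c , c<b) =
        ≤-trans (proj₁ (extremal a (∈-outer⁺ a∈ ¬strictlyBetween-left))) (<⇒≤ a<c) ,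
        ≤-trans (<⇒≤ c<b) (proj₂ (extremal b (∈-outer⁺ b∈ ¬strictlyBetween-right)))
    PolygonEdge-outer a∈ b∈ {x , y} (x<y , x∈ , y∈ , inj₁ consecutive) with (x ≟ a) ×-dec (y ≟ b)
    ... | yes (refl , refl) = inj₂ refl
    ... | no ≢ab =
      inj₁ (x<y , proj₁ (∈-outer⁻ x∈) , proj₁ (∈-outer⁻ y∈) , inj₁ λ c c∈ x<c<y → ≢ab (straddles c∈ x<c<y))
      where
      a∈ₒ : a ∈ₛ outer W a b
      a∈ₒ = ∈-outer⁺ a∈ ¬strictlyBetween-left
      b∈ₒ : b ∈ₛ outer W a b
      b∈ₒ = ∈-outer⁺ b∈ ¬strictlyBetween-right
      straddles : c ∈ₛ W → x < c × c < y → x ≡ a × y ≡ b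
      straddles {c} c∈ (x<c , c<y) with strictlyBetween? a b c
      ... | no c∉ab = ⊥-elim (consecutive c (∈-outer⁺ c∈ c∉ab) (x<c , c<y))
      ... | yes (a<c , c<b) =
        ≤-antisym (≮⇒≥ λ a<x → proj₂ (∈-outer⁻ x∈) (a<x , <-trans x<c c<b))
                  (≮⇒≥ λ x<a → consecutive a a∈ₒ (x<a , <-trans a<c c<y)) ,
        ≤-antisym (≮⇒≥ λ y<b → consecutive b b∈ₒ (<-trans x<c c<b , y<b))
                  (≮⇒≥ λ b<y → proj₂ (∈-outer⁻ y∈) (<-trans a<c c<y , b<y))

    ++-triangulation : a ∈ₛ W → b ∈ₛ W → a < b →
      Triangulation (inner W a b) T₁ → Triangulation (outer W a b) T₂ → Triangulation W (T₁ ++ T₂)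
    ++-triangulation {T₁} {T₂} a∈ b∈ a<b (edges₁ , noncrossing₁ , maximal₁)
                                         (edges₂ , noncrossing₂ , maximal₂) =
      edges , noncrossing , maximal
      where
      edges : EdgesIn W (T₁ ++ T₂)
      edges x y xy∈ with ∈-++⁻ T₁ xy∈
      ... | inj₁ xy∈₁ = let x<y , x∈ , y∈ = edges₁ x y xy∈₁ in x<y , proj₁ (∈-inner⁻ x∈) , proj₁ (∈-inner⁻ y∈)
      ... | inj₂ xy∈₂ = let x<y , x∈ , y∈ = edges₂ x y xy∈₂ in x<y , proj₁ (∈-outer⁻ x∈) , proj₁ (∈-outer⁻ y∈)

      within : (x , y) ∈ T₁ → a ≤ x × y ≤ b
      within {x} {y} xy∈ =
        let _ , x∈ , y∈ = edges₁ x y xy∈ in proj₁ (proj₂ (∈-inner⁻ x∈)) , proj₂ (proj₂ (∈-inner⁻ y∈))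

      outside : (u , m) ∈ T₂ → ¬ StrictlyBetween a b u × ¬ StrictlyBetween a b m
      outside {u} {m} um∈ =
        let _ , u∈ , m∈ = edges₂ u m um∈ in proj₂ (∈-outer⁻ u∈) , proj₂ (∈-outer⁻ m∈)

      inner-outer : (x , y) ∈ T₁ → (u , m) ∈ T₂ → ¬ Cross (x , y) (u , m)
      inner-outer xy∈ um∈ = ¬Cross-inner-outer (within xy∈) (outside um∈)

      noncrossing : NonCrossing (T₁ ++ T₂)
      noncrossing (x , y) (u , m) e∈ f∈ with ∈-++⁻ T₁ e∈ | ∈-++⁻ T₁ f∈
      ... | inj₁ e∈₁ | inj₁ f∈₁ = noncrossing₁ _ _ e∈₁ f∈₁
      ... | inj₂ e∈₂ | inj₂ f∈₂ = noncrossing₂ _ _ e∈₂ f∈₂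
      ... | inj₁ e∈₁ | inj₂ f∈₂ = inner-outer e∈₁ f∈₂
      ... | inj₂ e∈₂ | inj₁ f∈₁ = inner-outer f∈₁ e∈₂ ∘ Cross-sym

      diagonal∈ : (a , b) ∈ T₁ ++ T₂
      diagonal∈ = ∈-++⁺ˡ (maximal₁ a b (∈-inner⁺ a∈ (≤-refl , <⇒≤ a<b)) (∈-inner⁺ b∈ (<⇒≤ a<b , ≤-refl)) a<b
        λ { (_ , _) xy∈ →
              ¬Cross-inner-outer (within xy∈) (¬strictlyBetween-left , ¬strictlyBetween-right) ∘ Cross-sym })

      -- A pair with one end strictly inside (a , b) and the other outside [a , b] crosses the diagonal.
      maximal : Maximal W (T₁ ++ T₂)
      maximal x y x∈ y∈ x<y noncrossing-xy with (a ≤? x) ×-dec (y ≤? b)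
      ... | yes (a≤x , y≤b) = ∈-++⁺ˡ (maximal₁ x y (∈-inner⁺ x∈ (a≤x , ≤-trans (<⇒≤ x<y) y≤b))
                                                (∈-inner⁺ y∈ (≤-trans a≤x (<⇒≤ x<y) , y≤b)) x<y
                                                (λ f → noncrossing-xy f ∘ ∈-++⁺ˡ))
      ... | no ¬inside with strictlyBetween? a b x | strictlyBetween? a b y
      ...   | no x∉ab | no y∉ab = ∈-++⁺ʳ T₁ (maximal₂ x y (∈-outer⁺ x∈ x∉ab) (∈-outer⁺ y∈ y∉ab) x<y
                                                      (λ f → noncrossing-xy f ∘ ∈-++⁺ʳ T₁))
      ...   | yes (a<x , x<b) | _ =
        ⊥-elim (noncrossing-xy _ diagonal∈ (inj₂ (a<x , x<b , ≰⇒> λ y≤b → ¬inside (<⇒≤ a<x , y≤b))))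
      ...   | no _ | yes (a<y , y<b) =
        ⊥-elim (noncrossing-xy _ diagonal∈ (inj₁ (≰⇒> (λ a≤x → ¬inside (a≤x , <⇒≤ y<b)) , a<y , y<b)))

  segment-triangulation : x ∈ₛ W → y ∈ₛ W → x < y → (∀ u → u ∈ₛ W → u ≡ x ⊎ u ≡ y) →
                          Triangulation W ((x , y) ∷ [])
  segment-triangulation {x = x} {W = W} {y = y} x∈ y∈ x<y vertex = edges , noncrossing , maximal
    where
    edges : EdgesIn W ((x , y) ∷ [])
    edges _ _ (here refl) = x<y , x∈ , y∈
    noncrossing : NonCrossing ((x , y) ∷ [])
    noncrossing _ _ (here refl) (here refl) = ¬Cross-shared (inj₁ refl)
    maximal : Maximal W ((x , y) ∷ [])
    maximal a b a∈ b∈ a<b _ with vertex a a∈ | vertex b b∈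
    ... | inj₁ refl | inj₂ refl = here refl
    ... | inj₁ refl | inj₁ refl = ⊥-elim (<-irrefl refl a<b)
    ... | inj₂ refl | inj₂ refl = ⊥-elim (<-irrefl refl a<b)
    ... | inj₂ refl | inj₁ refl = ⊥-elim (<-asym a<b x<y)

  triangle : Fin n → Fin n → Fin n → EdgeList n
  triangle x y z = (x , y) ∷ (y , z) ∷ (x , z) ∷ []

  triangle-triangulation : x ∈ₛ W → y ∈ₛ W → z ∈ₛ W → x < y → y < z →
                           (∀ u → u ∈ₛ W → u ≡ x ⊎ u ≡ y ⊎ u ≡ z) →
                           Triangulation W (triangle x y z)
  triangle-triangulation {x = x} {W = W} {y = y} {z = z} x∈ y∈ z∈ x<y y<z vertex =
    edges , noncrossing , maximal
    where
    x<z : x < z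
    x<z = <-trans x<y y<z
    edges : EdgesIn W (triangle x y z)
    edges _ _ (here refl) = x<y , x∈ , y∈
    edges _ _ (there (here refl)) = y<z , y∈ , z∈
    edges _ _ (there (there (here refl))) = x<z , x∈ , z∈
    noncrossing : NonCrossing (triangle x y z)
    noncrossing _ _ (here refl) (here refl) = ¬Cross-shared (inj₁ refl)
    noncrossing _ _ (here refl) (there (here refl)) = ¬Cross-shared (inj₂ (inj₂ (inj₁ refl)))
    noncrossing _ _ (here refl) (there (there (here refl))) = ¬Cross-shared (inj₁ refl)
    noncrossing _ _ (there (here refl)) (here refl) = ¬Cross-shared (inj₂ (inj₁ refl))
    noncrossing _ _ (there (here refl)) (there (here refl)) = ¬Cross-shared (inj₁ refl)
    noncrossing _ _ (there (here refl)) (there (there (here refl))) = ¬Cross-shared (inj₂ (inj₂ (inj₂ refl)))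
    noncrossing _ _ (there (there (here refl))) (here refl) = ¬Cross-shared (inj₁ refl)
    noncrossing _ _ (there (there (here refl))) (there (here refl)) = ¬Cross-shared (inj₂ (inj₂ (inj₂ refl)))
    noncrossing _ _ (there (there (here refl))) (there (there (here refl))) = ¬Cross-shared (inj₁ refl)
    maximal : Maximal W (triangle x y z)
    maximal a b a∈ b∈ a<b _ with vertex a a∈ | vertex b b∈
    ... | inj₁ refl | inj₂ (inj₁ refl) = here refl
    ... | inj₂ (inj₁ refl) | inj₂ (inj₂ refl) = there (here refl)
    ... | inj₁ refl | inj₂ (inj₂ refl) = there (there (here refl))
    ... | inj₁ refl | inj₁ refl = ⊥-elim (<-irrefl refl a<b)
    ... | inj₂ (inj₁ refl) | inj₂ (inj₁ refl) = ⊥-elim (<-irrefl refl a<b)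
    ... | inj₂ (inj₂ refl) | inj₂ (inj₂ refl) = ⊥-elim (<-irrefl refl a<b)
    ... | inj₂ (inj₁ refl) | inj₁ refl = ⊥-elim (<-asym a<b x<y)
    ... | inj₂ (inj₂ refl) | inj₁ refl = ⊥-elim (<-asym a<b x<z)
    ... | inj₂ (inj₂ refl) | inj₂ (inj₁ refl) = ⊥-elim (<-asym a<b y<z)

  straddling-polygonEdge : x ∈ₛ W → y ∈ₛ W → x ≤ m → m < y →
                           ∃₂ λ p s → PolygonEdge W (p , s) × x ≤ p × p ≤ m × m < s
  straddling-polygonEdge {W = W} {m = m} x∈ y∈ x≤m m<y
    with greatest (λ u → (u ∈? W) ×-dec (u ≤? m)) (_ , x∈ , x≤m)
       | least (λ u → (u ∈? W) ×-dec (m <? u)) (_ , y∈ , m<y)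
  ... | p , (p∈ , p≤m) , ≤p | s , (s∈ , m<s) , s≤ =
    p , s , (≤-<-trans p≤m m<s , p∈ , s∈ , inj₁ consecutive) , ≤p _ (x∈ , x≤m) , p≤m , m<s
    where
    consecutive : ∀ c → c ∈ₛ W → ¬ (p < c × c < s)
    consecutive c c∈ (p<c , c<s) with c ≤? m
    ... | yes c≤m = <⇒≱ p<c (≤p c (c∈ , c≤m))
    ... | no c≰m = <⇒≱ c<s (s≤ c (c∈ , ≰⇒> c≰m))

  record Frame (W : Subset n) : Set where
    constructor mkFrame
    field
      w₀ w₁ wₖ : Fin n
      least₀ : IsLeast (_∈ₛ W) w₀
      next₁ : IsLeast (λ x → x ∈ₛ W × w₀ < x) w₁
      greatestₖ : IsGreatest (_∈ₛ W) wₖ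

    w₀∈ : w₀ ∈ₛ W
    w₀∈ = proj₁ least₀

    w₁∈ : w₁ ∈ₛ W
    w₁∈ = proj₁ (proj₁ next₁)

    wₖ∈ : wₖ ∈ₛ W
    wₖ∈ = proj₁ greatestₖ

    w₀<w₁ : w₀ < w₁
    w₀<w₁ = proj₂ (proj₁ next₁)

    ≤wₖ : u ∈ₛ W → u ≤ wₖ
    ≤wₖ u∈ = proj₂ greatestₖ _ u∈

    w₀<wₖ : w₀ < wₖ
    w₀<wₖ = <-≤-trans w₀<w₁ (≤wₖ w₁∈)

    ≡w₀⊎w₁≤ : u ∈ₛ W → u ≡ w₀ ⊎ w₁ ≤ u
    ≡w₀⊎w₁≤ {u = u} u∈ with u ≟ w₀
    ... | yes u≡w₀ = inj₁ u≡w₀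
    ... | no u≢w₀ = inj₂ (proj₂ next₁ u (u∈ , ≤∧≢⇒< (proj₂ least₀ u u∈) (u≢w₀ ∘ sym)))

    first-polygonEdge : PolygonEdge W (w₀ , w₁)
    first-polygonEdge = w₀<w₁ , w₀∈ , w₁∈ , inj₁ λ c c∈ (w₀<c , c<w₁) → <⇒≱ c<w₁ (proj₂ next₁ c (c∈ , w₀<c))

    base-polygonEdge : PolygonEdge W (w₀ , wₖ)
    base-polygonEdge = w₀<wₖ , w₀∈ , wₖ∈ , inj₂ λ c c∈ → proj₂ least₀ c c∈ , ≤wₖ c∈

  frame : a ∈ₛ W → b ∈ₛ W → a < b → Frame W
  frame {W = W} a∈ b∈ a<b with least (_∈? W) (_ , a∈) | greatest (_∈? W) (_ , a∈)
  ... | w₀ , least₀ | wₖ , greatestₖ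
    with least (λ x → (x ∈? W) ×-dec (w₀ <? x))
               (wₖ , proj₁ greatestₖ , ≤-<-trans (proj₂ least₀ _ a∈) (<-≤-trans a<b (proj₂ greatestₖ _ b∈)))
  ...   | w₁ , next₁ = mkFrame w₀ w₁ wₖ least₀ next₁ greatestₖ

  CondL-shrinkˡ : ∀ {L : EdgeList n} {a′} → a ≤ a′ → CondL L (a , b) → CondL L (a′ , b)
  CondL-shrinkˡ a≤a′ condL l₁ l₂ l∈ (a′<l₁ , l₁<b , b<l₂) =
    condL l₁ l₂ l∈ (≤-<-trans a≤a′ a′<l₁ , l₁<b , b<l₂)

  CondR-shrinkʳ : ∀ {R : EdgeList n} {b′} → b′ ≤ b → CondR R (a , b) → CondR R (a , b′)
  CondR-shrinkʳ b′≤b condR r₁ r₂ r∈ (r₁<a , a<r₂ , r₂<b′) =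
    condR r₁ r₂ r∈ (r₁<a , a<r₂ , <-≤-trans r₂<b′ b′≤b)

  CondL-extend : ∀ {L R : EdgeList n} {r₁ r₂} → Compatible L R → (r₁ , r₂) ∈ R → r₁ < m → m < r₂ →
                 CondL L (a , m) → CondL L (a , r₂)
  CondL-extend {m = m} compatible r∈ r₁<m m<r₂ condL l₁ l₂ l∈ (a<l₁ , l₁<r₂ , r₂<l₂) with l₁ <? m
  ... | yes l₁<m = condL l₁ l₂ l∈ (a<l₁ , l₁<m , <-trans m<r₂ r₂<l₂)
  ... | no l₁≮m = compatible _ _ l∈ r∈ (<-≤-trans r₁<m (≮⇒≥ l₁≮m) , l₁<r₂ , r₂<l₂)

  module _ {n} (L R : EdgeList n) (compatible : Compatible L R) where

    Good : Edge n → Set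
    Good e = CondL L e × CondR R e

    GoodPolygon : Subset n → Set
    GoodPolygon W = ∀ e → PolygonEdge W e → Good e

    GoodTriangulation : Subset n → Set
    GoodTriangulation W = Σ (EdgeList n) λ T → Triangulation W T × (∀ e → e ∈ T → Good e)

    GoodTriangulable : Subset n → Set
    GoodTriangulable W = ∀ {a b} → a ∈ₛ W → b ∈ₛ W → a < b → GoodPolygon W → GoodTriangulation W

    inner-good : a ∈ₛ W → b ∈ₛ W → a ≤ b → Good (a , b) → GoodPolygon W → GoodPolygon (inner W a b)
    inner-good a∈ b∈ a≤b good-ab good e e-edge =
      [ good e , (λ e≡ab → subst Good (sym e≡ab) good-ab) ]′ (PolygonEdge-inner a∈ b∈ a≤b e-edge)

    outer-good : a ∈ₛ W → b ∈ₛ W → Good (a , b) → GoodPolygon W → GoodPolygon (outer W a b)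
    outer-good a∈ b∈ good-ab good e e-edge =
      [ good e , (λ e≡ab → subst Good (sym e≡ab) good-ab) ]′ (PolygonEdge-outer a∈ b∈ e-edge)

    glue : a ∈ₛ W → b ∈ₛ W → a < b →
           GoodTriangulation (inner W a b) → GoodTriangulation (outer W a b) → GoodTriangulation W
    glue a∈ b∈ a<b (T₁ , t₁ , good₁) (T₂ , t₂ , good₂) =
      T₁ ++ T₂ , ++-triangulation a∈ b∈ a<b t₁ t₂ , λ e e∈ → [ good₁ e , good₂ e ]′ (∈-++⁻ T₁ e∈)

    R-endpoint∈ : ∀ {r₁ r₂} → GoodPolygon W → (r₁ , r₂) ∈ R → x ∈ₛ W → y ∈ₛ W →
                  r₁ < x → x ≤ r₂ → r₂ < y → r₂ ∈ₛ W
    R-endpoint∈ {W = W} {r₂ = r₂} good r∈ x∈ y∈ r₁<x x≤r₂ r₂<y with r₂ ∈? W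
    ... | yes r₂∈ = r₂∈
    ... | no r₂∉ with straddling-polygonEdge x∈ y∈ x≤r₂ r₂<y
    ...   | p , s , edge@(_ , p∈ , _) , x≤p , p≤r₂ , r₂<s =
      ⊥-elim (proj₂ (good _ edge) _ _ r∈ (<-≤-trans r₁<x x≤p , ≤∧≢⇒< p≤r₂ (λ { refl → r₂∉ p∈ }) , r₂<s))

    good-diagonal : ∀ {w₀ w₁ wₖ} → GoodPolygon W → w₁ ∈ₛ W → wₖ ∈ₛ W → w₀ < w₁ → w₁ < wₖ →
                    Good (w₀ , w₁) → Good (w₀ , wₖ) →
                    Good (w₁ , wₖ) ⊎ ∃ λ c → c ∈ₛ W × w₁ < c × c < wₖ × Good (w₀ , c)
    good-diagonal {w₁ = w₁} {wₖ} good w₁∈ wₖ∈ w₀<w₁ w₁<wₖ (condL₀₁ , _) (condL₀ₖ , condR₀ₖ)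
      with any? (λ r → (proj₁ r <? w₁) ×-dec (w₁ <? proj₂ r) ×-dec (proj₂ r <? wₖ)) R
    ... | no none = inj₁ (CondL-shrinkˡ (<⇒≤ w₀<w₁) condL₀ₖ , λ _ _ r∈ → none ∘ lose r∈)
    ... | yes some with find some
    ...   | _ , r∈ , r₁<w₁ , w₁<r₂ , r₂<wₖ =
      inj₂ (_ , R-endpoint∈ good r∈ w₁∈ wₖ∈ r₁<w₁ (<⇒≤ w₁<r₂) r₂<wₖ , w₁<r₂ , r₂<wₖ ,
            CondL-extend compatible r∈ r₁<w₁ w₁<r₂ condL₀₁ , CondR-shrinkʳ (<⇒≤ r₂<wₖ) condR₀ₖ)

    module _ {W : Subset n} (ih : ∀ {W′} → W′ ⊂ W → GoodTriangulable W′) (good : GoodPolygon W) where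

      triangulate-inner : a ∈ₛ W → b ∈ₛ W → a < b → Good (a , b) → y ∈ₛ W → ¬ Between a b y →
                          GoodTriangulation (inner W a b)
      triangulate-inner {a = a} {b = b} a∈ b∈ a<b good-ab y∈ y∉ =
        ih {inner W a b} (inner-⊂ y∈ y∉) (∈-inner⁺ {a = a} {b} a∈ (≤-refl , <⇒≤ a<b))
           (∈-inner⁺ {a = a} {b} b∈ (<⇒≤ a<b , ≤-refl)) a<b
           (inner-good a∈ b∈ (<⇒≤ a<b) good-ab good)

      triangulate-outer : a ∈ₛ W → b ∈ₛ W → a < b → Good (a , b) → y ∈ₛ W → StrictlyBetween a b y →
                          GoodTriangulation (outer W a b)
      triangulate-outer {a = a} {b = b} a∈ b∈ a<b good-ab y∈ y∈ab =
        ih {outer W a b} (outer-⊂ y∈ y∈ab) (∈-outer⁺ {a = a} {b} a∈ ¬strictlyBetween-left)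
           (∈-outer⁺ {a = a} {b} b∈ ¬strictlyBetween-right) a<b
           (outer-good a∈ b∈ good-ab good)

      module _ (f : Frame W) where
        open Frame f

        good₀₁ : Good (w₀ , w₁)
        good₀₁ = good _ first-polygonEdge

        good₀ₖ : Good (w₀ , wₖ)
        good₀ₖ = good _ base-polygonEdge

        two-vertex-case : w₁ ≡ wₖ → GoodTriangulation W
        two-vertex-case w₁≡wₖ =
          (w₀ , wₖ) ∷ [] , segment-triangulation w₀∈ wₖ∈ w₀<wₖ vertex , λ { _ (here refl) → good₀ₖ }
          where
          vertex : ∀ u → u ∈ₛ W → u ≡ w₀ ⊎ u ≡ wₖ
          vertex u u∈ with ≡w₀⊎w₁≤ u∈
          ... | inj₁ u≡w₀ = inj₁ u≡w₀
          ... | inj₂ w₁≤u = inj₂ (≤-antisym (≤wₖ u∈) (subst (_≤ u) w₁≡wₖ w₁≤u))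

        ear-case : w₁ < wₖ → Good (w₁ , wₖ) → GoodTriangulation W
        ear-case w₁<wₖ good₁ₖ =
          glue w₁∈ wₖ∈ w₁<wₖ (triangulate-inner w₁∈ wₖ∈ w₁<wₖ good₁ₖ w₀∈ (<⇒≱ w₀<w₁ ∘ proj₁)) ear
          where
          vertex : ∀ u → u ∈ₛ outer W w₁ wₖ → u ≡ w₀ ⊎ u ≡ w₁ ⊎ u ≡ wₖ
          vertex u u∈ with ∈-outer⁻ u∈
          ... | u∈W , u∉ with ≡w₀⊎w₁≤ u∈W
          ...   | inj₁ u≡w₀ = inj₁ u≡w₀
          ...   | inj₂ w₁≤u with ≤⇒<⊎≡ w₁≤u
          ...     | inj₂ w₁≡u = inj₂ (inj₁ (sym w₁≡u))
          ...     | inj₁ w₁<u = inj₂ (inj₂ (≤-antisym (≤wₖ u∈W) (≮⇒≥ λ u<wₖ → u∉ (w₁<u , u<wₖ))))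

          goods : ∀ e → e ∈ triangle w₀ w₁ wₖ → Good e
          goods _ (here refl) = good₀₁
          goods _ (there (here refl)) = good₁ₖ
          goods _ (there (there (here refl))) = good₀ₖ

          ear : GoodTriangulation (outer W w₁ wₖ)
          ear = triangle w₀ w₁ wₖ ,
                triangle-triangulation (∈-outer⁺ {a = w₁} {wₖ} w₀∈ (<-asym w₀<w₁ ∘ proj₁))
                                       (∈-outer⁺ {a = w₁} {wₖ} w₁∈ ¬strictlyBetween-left)
                                       (∈-outer⁺ {a = w₁} {wₖ} wₖ∈ ¬strictlyBetween-right) w₀<w₁ w₁<wₖ vertex ,
                goods

        diagonal-case : c ∈ₛ W → w₁ < c → c < wₖ → Good (w₀ , c) → GoodTriangulation W
        diagonal-case {c = c} c∈ w₁<c c<wₖ good₀c =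
          glue w₀∈ c∈ w₀<c (triangulate-inner w₀∈ c∈ w₀<c good₀c wₖ∈ (<⇒≱ c<wₖ ∘ proj₂))
                           (triangulate-outer w₀∈ c∈ w₀<c good₀c w₁∈ (w₀<w₁ , w₁<c))
          where
          w₀<c : w₀ < c
          w₀<c = <-trans w₀<w₁ w₁<c

        frame-step : GoodTriangulation W
        frame-step with ≤⇒<⊎≡ (≤wₖ w₁∈)
        ... | inj₂ w₁≡wₖ = two-vertex-case w₁≡wₖ
        ... | inj₁ w₁<wₖ with good-diagonal good w₁∈ wₖ∈ w₀<w₁ w₁<wₖ good₀₁ good₀ₖ
        ...   | inj₁ good₁ₖ = ear-case w₁<wₖ good₁ₖ
        ...   | inj₂ (c , c∈ , w₁<c , c<wₖ , good₀c) = diagonal-case c∈ w₁<c c<wₖ good₀c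

    triangulate : Acc _⊂_ W → GoodTriangulable W
    triangulate (acc smaller) a∈ b∈ a<b good = frame-step (triangulate ∘ smaller) good (frame a∈ b∈ a<b)

open import Data.Nat using (ℕ; _≤_)

-- Two vertices already suffice, and the members of L and R need not be genuine edges.
proposition3p9 : (n : ℕ) (L R : EdgeList n) → ValidEdges L → ValidEdges R →
    Compatible L R → (V : Subset n) → 3 ≤ ∣ V ∣ →
    (∀ e → PolygonEdge V e → CondL L e × CondR R e) →
    Σ (EdgeList n) (λ T → Triangulation V T × (∀ e → e ∈ T → CondL L e × CondR R e))
proposition3p9 n L R _ _ compatible V 3≤∣V∣ good with two-elements (ℕ.≤-trans (ℕ.n≤1+n 2) 3≤∣V∣)
... | a , b , a∈ , b∈ , a<b = triangulate L R compatible (⊂-wellFounded V) a∈ b∈ a<b good
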